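{- Let $m,n\ge 1$ be integers and $k\ge 0$ an integer. Let $L_{m,n}$ be the lollipop graph with vertex set $\{x_1,\dots,x_m,y_1,\dots,y_n\}$ and edges $x_ix_j$ for $1\le i<j\le m$, $x_my_1$, and $y_iy_{i+1}$ for $1\le i<n$. Define the weight function $D_k$ on $V(L_{m,n})$ by $D_k(x_j)=d_{x_j}+k$ for $1\le j\le m$ (where $d_{x_j}$ is the degree of $x_j$ in $L_{m,n}$) and $D_k(y_j)=2$ for $1\le j\le n$. Then $$R(L_{m,n},D_k)=\big((m+k)(n+1)-n\big)(k+1)(m+k)^{m-2}-(m-1)(m+k)^{m-2}(n+1).$$
   Context: For a vertex-weighted graph $(G',w)$ (a finite simple graph $G'$ with $w:V(G')\to\mathbb R$), the invariant $R(G',w)$ is defined by $R(\emptyset,w)=1$ and, for any vertex $x$ of $G'$, $$R(G',w)=w_xR(G'-\{x\},w)-\sum_{\substack{z\in V(G')\\ z\sim x}}\sum_{Q\in\mathscr P_{G'}(x,z)}R(G'-\{Q\},w),$$ where $z\sim x$ means adjacency, $\mathscr P_{G'}(x,z)$ is the set of simple paths from $x$ to $z$ in $G'$, $G'-\{Q\}$ is the induced subgraph obtained by deleting the vertices of $Q$, and $w$ is restricted to subgraphs; these relations determine $R$ uniquely. Equivalently, when $w$ is integer-valued with $w_v\ge\deg_{G'}(v)$, $R(G',w)$ is the number of spanning trees of the multigraph obtained from $G'$ by adding a new vertex $\bullet$ and $w_v-\deg_{G'}(v)$ edges between $\bullet$ and each $v$. -}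

module Defs where

open import Data.Bool using (Bool; true; false; not; _∧_; _∨_; if_then_else_; T?)
open import Data.Nat as ℕ using (ℕ; zero; suc)
open import Data.Integer as ℤ using (ℤ; +_; -[1+_])
open import Data.Rational as ℚ using (ℚ; 0ℚ; 1ℚ; 1/_; ≢-nonZero)
open import Data.List using (List; []; _∷_; _++_; length; filter; map; concatMap; upTo)
open import Data.Sum using (_⊎_; inj₁; inj₂)
open import Data.Sum.Properties using (≡-dec)
open import Relation.Nullary using (yes; no; ¬_; does)
open import Relation.Binary using (DecidableEquality)
open import Relation.Binary.PropositionalEquality using (_≡_)

-- A (finite simple) graph is given by a list of (distinct) vertices of a
-- type V with decidable equality and a Boolean adjacency relation on V
-- that is symmetric and irreflexive.  Induced subgraphs are obtained by
-- shrinking the vertex list (adjacency is inherited).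

record Graph (V : Set) : Set₁ where
  field
    verts     : List V
    adj       : V → V → Bool
    _≟v_      : DecidableEquality V

module _ {V : Set} (_≟_ : DecidableEquality V) (adj : V → V → Bool) where

  _∈?ᵇ_ : V → List V → Bool
  v ∈?ᵇ []       = false
  v ∈?ᵇ (u ∷ us) = does (v ≟ u) ∨ (v ∈?ᵇ us)

  minus : List V → List V → List V
  minus S Q = filter (λ v → T? (not (v ∈?ᵇ Q))) S

  degree : List V → V → ℕ
  degree S v = length (filter (λ u → adj v u Data.Bool.≟ true) S)
    where import Data.Bool

  -- The current path is stored
  -- in reverse (head = current endpoint); 'avail' are the vertices not yet
  -- used.  Returns all simple paths (again reversed) extending it,
  -- including the path itself.  Fuel = length of avail.
  extend : ℕ → List V → List V → List (List V)
  extend zero    rpath avail = rpath ∷ []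
  extend (suc f) []    avail = [] ∷ []
  extend (suc f) (v ∷ rp) avail =
    (v ∷ rp) ∷ concatMap
      (λ u → if adj v u then extend f (u ∷ v ∷ rp) (minus avail (u ∷ [])) else [])
      avail

  -- All simple paths Q in the graph on S from x to some z with z ∼ x
  -- (as vertex lists; order irrelevant for G - {Q}).
  closingPaths : List V → V → List (List V)
  closingPaths S x = filter ok (extend (length S) (x ∷ []) (minus S (x ∷ [])))
    where
    okᵇ : List V → Bool
    okᵇ []          = false
    okᵇ (z ∷ [])    = false
    okᵇ (z ∷ _ ∷ _) = adj x z
    ok = λ Q → T? (okᵇ Q)

  module _ (w : V → ℤ) where

    sumℤ : List ℤ → ℤ
    sumℤ []       = + 0
    sumℤ (a ∷ as) = a ℤ.+ sumℤ as

    -- R with fuel; the recursion expands along the first vertex x of the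
    -- vertex list:
    --   R(G) = w_x R(G - x) - Σ_{z ∼ x} Σ_{Q ∈ P(x,z)} R(G - Q).
    Rf : ℕ → List V → ℤ
    Rf zero    S       = + 1
    Rf (suc f) []      = + 1
    Rf (suc f) (x ∷ S) =
      w x ℤ.* Rf f S ℤ.- sumℤ (map (λ Q → Rf f (minus (x ∷ S) Q)) (closingPaths (x ∷ S) x))

    R : List V → ℤ
    R S = Rf (length S) S

-- Lollipop graph L_{m,n}: x_i = inj₁ i (1 ≤ i ≤ m), y_j = inj₂ j (1 ≤ j ≤ n).

LV : Set
LV = ℕ ⊎ ℕ

_≟L_ : DecidableEquality LV
_≟L_ = ≡-dec ℕ._≟_ ℕ._≟_

range1 : ℕ → List ℕ
range1 n = map suc (upTo n)

lollipopVerts : ℕ → ℕ → List LV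
lollipopVerts m n = map inj₁ (range1 m) ++ map inj₂ (range1 n)

lollipopAdj : ℕ → LV → LV → Bool
lollipopAdj m (inj₁ i) (inj₁ j) = not (i ℕ.≡ᵇ j)
lollipopAdj m (inj₁ i) (inj₂ j) = (i ℕ.≡ᵇ m) ∧ (j ℕ.≡ᵇ 1)
lollipopAdj m (inj₂ j) (inj₁ i) = (i ℕ.≡ᵇ m) ∧ (j ℕ.≡ᵇ 1)
lollipopAdj m (inj₂ i) (inj₂ j) = (suc i ℕ.≡ᵇ j) ∨ (suc j ℕ.≡ᵇ i)

Lollipop : ℕ → ℕ → Graph LV
Lollipop m n = record { verts = lollipopVerts m n ; adj = lollipopAdj m ; _≟v_ = _≟L_ }

Dk : ℕ → ℕ → ℕ → LV → ℤ
Dk m n k (inj₁ i) = + (degree _≟L_ (lollipopAdj m) (lollipopVerts m n) (inj₁ i) ℕ.+ k)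
Dk m n k (inj₂ j) = + 2

RG : {V : Set} → Graph V → (V → ℤ) → ℤ
RG G w = R (Graph._≟v_ G) (Graph.adj G) w (Graph.verts G)

-- Rational powers with integer exponent (needed for (m+k)^(m-2) when m = 1).

_^ℕ_ : ℚ → ℕ → ℚ
p ^ℕ zero  = 1ℚ
p ^ℕ suc n = p ℚ.* (p ^ℕ n)

-- p ^ e for e ∈ ℤ; for negative e and p = 0 we use the (irrelevant) value 0.
_^ℤ_ : ℚ → ℤ → ℚ
p ^ℤ (+ n)    = p ^ℕ n
p ^ℤ -[1+ n ] with p ℚ.≟ 0ℚ
... | yes _  = 0ℚ
... | no p≢0 = (1/_ p {{≢-nonZero p≢0}}) ^ℕ suc n

ℤ→ℚ : ℤ → ℚ
ℤ→ℚ z = z ℚ./ 1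

ℕ→ℚ : ℕ → ℚ
ℕ→ℚ n = ℤ→ℚ (+ n)

module Submission where

-- Expand R along a vertex x of the clique. The simple paths from x that close up at a neighbour of x
-- form a tree of path extensions; once such a path has entered the tail (necessarily through x_m) it can
-- never close, because no tail vertex is adjacent to x and the tail is only attached at x_m. Removing a
-- path from the clique therefore always leaves one of two shapes: q clique vertices together with x_m
-- and the whole tail, or q clique vertices beside a detached tail segment. On these two families R
-- (ρA, ρB) and the path-tree sums (σA, σB) obey linear recurrences in q: a path tree at a clique vertex
-- is its root term plus q subtrees, plus one subtree through x_m when x_m is still present. Once the
-- clique is used up, the vertex expanded next (x_m or a tail vertex) is pendant, so there
-- R(G) = w_x R(G - x) - R(G - x - u). Solving the recurrence for ρA at q = m - 1 gives the closed form.

open import Defs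
open import Data.Bool as Bool using (Bool; true; false; not; _∧_; _∨_; if_then_else_)
open import Data.Empty using (⊥; ⊥-elim)
open import Data.Unit using (⊤)
open import Data.Nat as ℕ using (ℕ; zero; suc; pred; _≤_; _<_; s≤s; z≤n)
import Data.Nat.Properties as ℕ
open import Data.Integer as ℤ using (ℤ; +_; -[1+_])
import Data.Integer.Properties as ℤ
open import Data.Integer.Tactic.RingSolver using (solve-∀)
open import Data.List using (List; []; _∷_; _++_; length; filter; map; concatMap; upTo; applyUpTo)
import Data.List.Properties as List
open import Data.List.Membership.Propositional using (_∈_)
open import Data.List.Membership.Propositional.Properties using (∈-map⁺; ∈-upTo⁺)
open import Data.List.Relation.Unary.All as All using (All; []; _∷_)
import Data.List.Relation.Unary.All.Properties as All
open import Data.List.Relation.Unary.Any using (here; there)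
open import Data.List.Relation.Unary.Unique.Propositional using (Unique; []; _∷_)
import Data.List.Relation.Unary.Unique.Propositional.Properties as Unique
open import Data.Product using (_×_; _,_; proj₁)
open import Data.Rational as ℚ using (0ℚ; 1ℚ; 1/_)
  renaming (_+_ to _+ℚ_; _*_ to _*ℚ_; _-_ to _-ℚ_; -_ to -ℚ_)
import Data.Rational.Properties as ℚ
open import Data.Rational.Unnormalised as ℚᵘ using (mkℚᵘ; *≡*)
import Data.Rational.Unnormalised.Properties as ℚᵘ
open import Data.Sum using (inj₁; inj₂)
open import Data.Sum.Properties using (inj₁-injective; inj₂-injective)
open import Function using (id; _∘_)
open import Relation.Binary using (DecidableEquality)
open import Relation.Binary.PropositionalEquality
open import Relation.Nullary using (yes; no; does; ¬?; contradiction)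
open import Relation.Nullary.Decidable using (dec-true; dec-false)
open import Relation.Unary using (Decidable)

if-true : ∀ {A : Set} {b} {t e : A} → b ≡ true → (if b then t else e) ≡ t
if-true refl = refl

module Expansion {V : Set} (_≟_ : DecidableEquality V) (adj : V → V → Bool) (w : V → ℤ) where

  open import Data.Integer using (_+_; _*_; _-_)

  Σ : List ℤ → ℤ
  Σ = sumℤ _≟_ adj w

  _∖_ : List V → List V → List V
  _∖_ = minus _≟_ adj

  Σ-++ : ∀ xs ys → Σ (xs ++ ys) ≡ Σ xs + Σ ys
  Σ-++ []       ys = sym (ℤ.+-identityˡ (Σ ys))
  Σ-++ (x ∷ xs) ys = trans (cong (_+_ x) (Σ-++ xs ys)) (sym (ℤ.+-assoc x (Σ xs) (Σ ys)))

  Σ-map-++ : ∀ {A : Set} (h : A → ℤ) xs ys → Σ (map h (xs ++ ys)) ≡ Σ (map h xs) + Σ (map h ys)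
  Σ-map-++ h xs ys = trans (cong Σ (List.map-++ h xs ys)) (Σ-++ (map h xs) (map h ys))

  Σ-map-cong : ∀ {A : Set} {g h : A → ℤ} xs → (∀ x → g x ≡ h x) → Σ (map g xs) ≡ Σ (map h xs)
  Σ-map-cong []       g≗h = refl
  Σ-map-cong (x ∷ xs) g≗h = cong₂ _+_ (g≗h x) (Σ-map-cong xs g≗h)

  Σ-map-const : ∀ {A : Set} (h : A → ℤ) c xs → All (λ x → h x ≡ c) xs → Σ (map h xs) ≡ + length xs * c
  Σ-map-const h c []       []         = sym (ℤ.*-zeroˡ c)
  Σ-map-const h c (x ∷ xs) (hx≡c ∷ p) = begin
    h x + Σ (map h xs)        ≡⟨ cong₂ _+_ hx≡c (Σ-map-const h c xs p) ⟩
    c + + length xs * c       ≡⟨ cong (_+ + length xs * c) (sym (ℤ.*-identityˡ c)) ⟩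
    + 1 * c + + length xs * c ≡⟨ sym (ℤ.*-distribʳ-+ c (+ 1) (+ length xs)) ⟩
    + suc (length xs) * c     ∎
    where open ≡-Reasoning

  Σ-map-zero : ∀ {A : Set} (h : A → ℤ) xs → All (λ x → h x ≡ + 0) xs → Σ (map h xs) ≡ + 0
  Σ-map-zero h []       []        = refl
  Σ-map-zero h (x ∷ xs) (hx≡0 ∷ p) = cong₂ _+_ hx≡0 (Σ-map-zero h xs p)

  Σ-map-concatMap : ∀ {A B : Set} (h : B → ℤ) (g : A → List B) xs →
    Σ (map h (concatMap g xs)) ≡ Σ (map (λ x → Σ (map h (g x))) xs)
  Σ-map-concatMap h g []       = refl
  Σ-map-concatMap h g (x ∷ xs) =
    trans (Σ-map-++ h (g x) (concatMap g xs)) (cong (_+_ (Σ (map h (g x)))) (Σ-map-concatMap h g xs))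

  Σ-map-filter : ∀ {A : Set} {P : A → Set} (P? : Decidable P) (h : A → ℤ) xs →
    Σ (map h (filter P? xs)) ≡ Σ (map (λ x → if does (P? x) then h x else + 0) xs)
  Σ-map-filter P? h []       = refl
  Σ-map-filter P? h (x ∷ xs) with does (P? x)
  ... | true  = cong (_+_ (h x)) (Σ-map-filter P? h xs)
  ... | false = trans (Σ-map-filter P? h xs) (sym (ℤ.+-identityˡ _))

  ∖-++ : ∀ L₁ L₂ Q → (L₁ ++ L₂) ∖ Q ≡ L₁ ∖ Q ++ L₂ ∖ Q
  ∖-++ L₁ L₂ Q = List.filter-++ _ L₁ L₂

  ∖-∷ : ∀ L u P → L ∖ (u ∷ P) ≡ (L ∖ P) ∖ (u ∷ [])
  ∖-∷ []      u P = refl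
  ∖-∷ (v ∷ L) u P with _∈?ᵇ_ _≟_ adj v P
  ... | true with does (v ≟ u)
  ...   | true  = ∖-∷ L u P
  ...   | false = ∖-∷ L u P
  ∖-∷ (v ∷ L) u P | false with does (v ≟ u)
  ...   | true  = ∖-∷ L u P
  ...   | false = cong (v ∷_) (∖-∷ L u P)

  ∖-self : ∀ v L → (v ∷ L) ∖ (v ∷ []) ≡ L ∖ (v ∷ [])
  ∖-self v L rewrite dec-true (v ≟ v) refl = refl

  ∖-keep : ∀ {u v} L → v ≢ u → (v ∷ L) ∖ (u ∷ []) ≡ v ∷ L ∖ (u ∷ [])
  ∖-keep {u} {v} L v≢u rewrite dec-false (v ≟ u) v≢u = refl

  ∖-fresh : ∀ u L → All (_≢ u) L → L ∖ (u ∷ []) ≡ L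
  ∖-fresh u []      []         = refl
  ∖-fresh u (v ∷ L) (v≢u ∷ p) = trans (∖-keep L v≢u) (cong (v ∷_) (∖-fresh u L p))

  ∖-head : ∀ x S → All (_≢ x) S → (x ∷ S) ∖ (x ∷ []) ≡ S
  ∖-head x S x∉S = trans (∖-self x S) (∖-fresh x S x∉S)

  ∖-extend : ∀ L P u {L′} → L ∖ P ≡ L′ → L ∖ (u ∷ P) ≡ L′ ∖ (u ∷ [])
  ∖-extend L P u L∖P≡L′ = trans (∖-∷ L u P) (cong (_∖ (u ∷ [])) L∖P≡L′)

  All-∖ : ∀ {P : V → Set} L Q → All P L → All P (L ∖ Q)
  All-∖ L Q = All.filter⁺ _

  R[_]_ : ℕ → List V → ℤ
  R[ f ] S = Rf _≟_ adj w f S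

  -- Paths are lists with the current endpoint at the head, as produced by `extend`.
  closes : V → List V → Bool
  closes x []          = false
  closes x (z ∷ [])    = false
  closes x (z ∷ _ ∷ _) = adj x z

  module PathSums (x : V) (S : List V) (f : ℕ) where

    term : List V → ℤ
    term Q = if closes x Q then R[ f ] ((x ∷ S) ∖ Q) else + 0

    extensionSum : ℕ → List V → List V → ℤ
    extensionSum fe P av = Σ (map term (extend _≟_ adj fe P av))

    branchSum : ℕ → V → List V → List V → V → ℤ
    branchSum fe v rp av u = if adj v u then extensionSum fe (u ∷ v ∷ rp) (av ∖ (u ∷ [])) else + 0

    growths : ℕ → V → List V → List V → V → List (List V)
    growths fe v rp av u = if adj v u then extend _≟_ adj fe (u ∷ v ∷ rp) (av ∖ (u ∷ [])) else []

    extensions : ℕ → V → List V → List V → List (List V)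
    extensions fe v rp av = concatMap (growths fe v rp av) av

    Σ-extensions : ∀ fe v rp av → Σ (map term (extensions fe v rp av)) ≡ Σ (map (branchSum fe v rp av) av)
    Σ-extensions fe v rp av =
      trans (Σ-map-concatMap term (growths fe v rp av) av) (Σ-map-cong av (λ u → Σ-growths (adj v u)))
      where
      Σ-growths : ∀ {u} b → Σ (map term (if b then extend _≟_ adj fe (u ∷ v ∷ rp) (av ∖ (u ∷ [])) else []))
                          ≡ (if b then extensionSum fe (u ∷ v ∷ rp) (av ∖ (u ∷ [])) else + 0)
      Σ-growths true  = refl
      Σ-growths false = refl

    extensionSum-suc : ∀ fe v rp av →
      extensionSum (suc fe) (v ∷ rp) av ≡ term (v ∷ rp) + Σ (map (branchSum fe v rp av) av)
    extensionSum-suc fe v rp av = cong (_+_ (term (v ∷ rp))) (Σ-extensions fe v rp av)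

    term-nonadjacent : ∀ {v} rp → adj x v ≡ false → term (v ∷ rp) ≡ + 0
    term-nonadjacent []      _ = refl
    term-nonadjacent (_ ∷ _) x≁v rewrite x≁v = refl

    branchSum-nonadjacent : ∀ fe {v} rp av {u} → adj v u ≡ false → branchSum fe v rp av u ≡ + 0
    branchSum-nonadjacent fe rp av v≁u rewrite v≁u = refl

    -- A path that has reached a region P of vertices not adjacent to the root, and that can only be
    -- continued inside P through available vertices (all in Q), never closes.
    module _ {P Q : V → Set} (P⇒nonadjacent : ∀ {v} → P v → adj x v ≡ false)
             (P-closed : ∀ {v u} → P v → Q u → adj v u ≡ true → P u) where

      extensionSum-vanishes : ∀ fe {v} rp av → P v → All Q av → extensionSum fe (v ∷ rp) av ≡ + 0
      branchSum-vanishes : ∀ fe {v} rp av {u} → P u → All Q av → branchSum fe v rp av u ≡ + 0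

      extensionSum-vanishes zero     rp av Pv Qav = cong (_+ + 0) (term-nonadjacent rp (P⇒nonadjacent Pv))
      extensionSum-vanishes (suc fe) {v} rp av Pv Qav = begin
        extensionSum (suc fe) (v ∷ rp) av                  ≡⟨ extensionSum-suc fe v rp av ⟩
        term (v ∷ rp) + Σ (map (branchSum fe v rp av) av) ≡⟨ cong₂ _+_ (term-nonadjacent rp (P⇒nonadjacent Pv))
                                                              (Σ-map-zero _ av (All.map branch≡0 Qav)) ⟩
        + 0                                                ∎
        where
        open ≡-Reasoning
        branch≡0 : ∀ {u} → Q u → branchSum fe v rp av u ≡ + 0
        branch≡0 {u} Qu = by-adjacency (adj v u) refl
          where
          by-adjacency : ∀ b → adj v u ≡ b → branchSum fe v rp av u ≡ + 0
          by-adjacency true  v∼u = branchSum-vanishes fe rp av (P-closed Pv Qu v∼u) Qav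
          by-adjacency false v≁u = branchSum-nonadjacent fe rp av v≁u

      branchSum-vanishes fe {v} rp av {u} Pu Qav with adj v u
      ... | true  = extensionSum-vanishes fe (v ∷ rp) (av ∖ (u ∷ [])) Pu (All-∖ av (u ∷ []) Qav)
      ... | false = refl

  Rf-∷ : ∀ f x S → All (_≢ x) S →
    R[ suc f ] (x ∷ S) ≡ w x * R[ f ] S - Σ (map (PathSums.branchSum x S f (length S) x [] S) S)
  Rf-∷ f x S x∉S = cong (w x * R[ f ] S -_) (begin
    Σ (map (λ Q → R[ f ] ((x ∷ S) ∖ Q)) (closingPaths _≟_ adj (x ∷ S) x))
      ≡⟨ trans (Σ-map-filter _ _ (extensions (length S) x [] av))
               (Σ-map-cong (extensions (length S) x [] av) (λ { [] → refl ; (_ ∷ []) → refl ; (_ ∷ _ ∷ _) → refl })) ⟩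
    Σ (map term (extensions (length S) x [] av))
      ≡⟨ Σ-extensions (length S) x [] av ⟩
    Σ (map (branchSum (length S) x [] av) av)
      ≡⟨ cong (λ av → Σ (map (branchSum (length S) x [] av) av)) (∖-head x S x∉S) ⟩
    Σ (map (branchSum (length S) x [] S) S) ∎)
    where
    open ≡-Reasoning
    open PathSums x S f
    av = (x ∷ S) ∖ (x ∷ [])

  Rf-pendant : ∀ f x u T → adj x u ≡ true → All (λ v → adj x v ≡ false) T →
    All (_≢ x) (u ∷ T) → All (_≢ u) T →
    R[ suc f ] (x ∷ u ∷ T) ≡ w x * R[ f ] (u ∷ T) - R[ f ] T
  Rf-pendant f x u T x∼u x≁T x∉ u∉T = begin
    R[ suc f ] (x ∷ u ∷ T)
      ≡⟨ Rf-∷ f x (u ∷ T) x∉ ⟩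
    w x * R[ f ] (u ∷ T) - (branchSum fe x [] (u ∷ T) u + Σ (map (branchSum fe x [] (u ∷ T)) T))
      ≡⟨ cong (λ z → w x * R[ f ] (u ∷ T) - z)
           (trans (cong₂ _+_ branch-u (Σ-map-zero _ T (All.map (branchSum-nonadjacent fe [] (u ∷ T)) x≁T)))
                  (ℤ.+-identityʳ _)) ⟩
    w x * R[ f ] (u ∷ T) - R[ f ] T ∎
    where
    open ≡-Reasoning
    open PathSums x (u ∷ T) f
    fe = length (u ∷ T)
    u∷T∖u : (u ∷ T) ∖ (u ∷ []) ≡ T
    u∷T∖u = ∖-head u T u∉T
    x∷u∷T∖ux : (x ∷ u ∷ T) ∖ (u ∷ x ∷ []) ≡ T
    x∷u∷T∖ux = trans (∖-extend (x ∷ u ∷ T) (x ∷ []) u (∖-head x (u ∷ T) x∉)) u∷T∖u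
    Σ-beyond-u : Σ (map (branchSum (length T) u (x ∷ []) T) T) ≡ + 0
    Σ-beyond-u = Σ-map-zero _ T (All.map
      (λ x≁v → branchSum-vanishes id (λ _ x≁v′ _ → x≁v′) (length T) (x ∷ []) T x≁v x≁T) x≁T)
    term-u : term (u ∷ x ∷ []) ≡ R[ f ] T
    term-u = trans (if-true x∼u) (cong R[ f ]_ x∷u∷T∖ux)
    branch-u : branchSum fe x [] (u ∷ T) u ≡ R[ f ] T
    branch-u = begin
      branchSum fe x [] (u ∷ T) u
        ≡⟨ trans (if-true x∼u) (cong (extensionSum fe (u ∷ x ∷ [])) u∷T∖u) ⟩
      extensionSum fe (u ∷ x ∷ []) T
        ≡⟨ extensionSum-suc (length T) u (x ∷ []) T ⟩
      term (u ∷ x ∷ []) + Σ (map (branchSum (length T) u (x ∷ []) T) T)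
        ≡⟨ cong₂ _+_ term-u Σ-beyond-u ⟩
      R[ f ] T + + 0
        ≡⟨ ℤ.+-identityʳ _ ⟩
      R[ f ] T ∎

module Degree {V : Set} (_≟_ : DecidableEquality V) (adj : V → V → Bool) where

  degree-++ : ∀ L₁ L₂ v → degree _≟_ adj (L₁ ++ L₂) v ≡ degree _≟_ adj L₁ v ℕ.+ degree _≟_ adj L₂ v
  degree-++ L₁ L₂ v = trans (cong length (List.filter-++ _ L₁ L₂)) (List.length-++ (filter _ L₁))

  degree-∷-adjacent : ∀ v u L → adj v u ≡ true → degree _≟_ adj (u ∷ L) v ≡ suc (degree _≟_ adj L v)
  degree-∷-adjacent v u L v∼u = cong length (List.filter-accept (λ u → adj v u Bool.≟ true) v∼u)

  degree-∷-nonadjacent : ∀ v u L → adj v u ≡ false → degree _≟_ adj (u ∷ L) v ≡ degree _≟_ adj L v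
  degree-∷-nonadjacent v u L v≁u =
    cong length (List.filter-reject (λ u → adj v u Bool.≟ true) (λ v∼u → contradiction (trans (sym v∼u) v≁u) λ ()))

  degree-nonadjacent : ∀ v L → All (λ u → adj v u ≡ false) L → degree _≟_ adj L v ≡ 0
  degree-nonadjacent v []      []            = refl
  degree-nonadjacent v (u ∷ L) (v≁u ∷ v≁L) = trans (degree-∷-nonadjacent v u L v≁u) (degree-nonadjacent v L v≁L)

interval : ℕ → ℕ → List ℕ
interval s zero    = []
interval s (suc t) = s ∷ interval (suc s) t

interval-lower : ∀ s t → All (s ≤_) (interval s t)
interval-lower s zero    = []
interval-lower s (suc t) = ℕ.≤-refl ∷ All.map ℕ.<⇒≤ (interval-lower (suc s) t)

delete : ℕ → List ℕ → List ℕ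
delete i = filter (λ c → ¬? (c ℕ.≟ i))

delete-self : ∀ i C → delete i (i ∷ C) ≡ delete i C
delete-self i C = List.filter-reject (λ c → ¬? (c ℕ.≟ i)) (λ i≢i → i≢i refl)

delete-keep : ∀ {i c} C → c ≢ i → delete i (c ∷ C) ≡ c ∷ delete i C
delete-keep {i} C = List.filter-accept (λ c → ¬? (c ℕ.≟ i))

delete-fresh : ∀ {i C} → All (_≢ i) C → delete i C ≡ C
delete-fresh = List.filter-all _

Unique-delete-∷ : ∀ i {C} → Unique C → Unique (i ∷ delete i C)
Unique-delete-∷ i {C} C! = All.map ≢-sym (All.all-filter (λ c → ¬? (c ℕ.≟ i)) C) ∷ Unique.filter⁺ _ C!

All-delete : ∀ {P : ℕ → Set} {i C} → All P C → All P (delete i C)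
All-delete = All.filter⁺ _

length-delete-≤ : ∀ i C → length (delete i C) ≤ length C
length-delete-≤ i = List.length-filter _

length-delete : ∀ {i C} → i ∈ C → Unique C → suc (length (delete i C)) ≡ length C
length-delete {i} {_ ∷ C} (here refl) (i∉C ∷ _) = cong (suc ∘ length) (begin
  delete i (i ∷ C) ≡⟨ delete-self i C ⟩
  delete i C       ≡⟨ delete-fresh (All.map ≢-sym i∉C) ⟩
  C                ∎)
  where open ≡-Reasoning
length-delete {i} {c ∷ C} (there i∈C) (c∉C ∷ C!) =
  trans (cong (suc ∘ length) (delete-keep C (All.lookup c∉C i∈C))) (cong suc (length-delete i∈C C!))

module _ (a : ℤ) where

  open import Data.Integer using (_+_; _*_; _-_)

  -- A path tree at a clique vertex with q clique vertices left: root term ρ q, q subtrees σ (q - 1),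
  -- and e q for the subtree through the apex.
  σ-split : (ρ σ e : ℕ → ℤ) → (∀ q → ρ (suc q) ≡ a * ρ q - σ q) → (∀ q → σ (suc q) ≡ a * σ q) →
    (∀ q → e (suc q) ≡ a * e q) → ρ 0 + e 0 ≡ σ 0 → ∀ q → ρ q + (+ q * σ (pred q) + e q) ≡ σ q
  σ-split ρ σ e ρ-suc σ-suc e-suc base zero =
    trans (cong (λ z → ρ 0 + (z + e 0)) (ℤ.*-zeroˡ (σ 0))) (trans (cong (_+_ (ρ 0)) (ℤ.+-identityˡ (e 0))) base)
  σ-split ρ σ e ρ-suc σ-suc e-suc base (suc q) = begin
    ρ (suc q) + (+ suc q * σ q + e (suc q))        ≡⟨ cong₂ (λ x y → x + (+ suc q * σ q + y)) (ρ-suc q) (e-suc q) ⟩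
    (a * ρ q - σ q) + (+ suc q * σ q + a * e q)    ≡⟨ rearrange a (ρ q) (σ q) (e q) (+ q) ⟩
    a * ρ q + (+ q * σ q + a * e q)                ≡⟨ cong (λ z → a * ρ q + (z + a * e q)) (σ-pred q) ⟩
    a * ρ q + (+ q * (a * σ (pred q)) + a * e q)   ≡⟨ factor a (ρ q) (σ (pred q)) (e q) (+ q) ⟩
    a * (ρ q + (+ q * σ (pred q) + e q))           ≡⟨ cong (a *_) (σ-split ρ σ e ρ-suc σ-suc e-suc base q) ⟩
    a * σ q                                        ≡⟨ sym (σ-suc q) ⟩
    σ (suc q)                                      ∎
    where
    open ≡-Reasoning
    rearrange : ∀ a r s e q → (a * r - s) + ((+ 1 + q) * s + a * e) ≡ a * r + (q * s + a * e)
    rearrange = solve-∀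
    factor : ∀ a r s e q → a * r + (q * (a * s) + a * e) ≡ a * (r + (q * s + e))
    factor = solve-∀
    σ-pred : ∀ q → + q * σ q ≡ + q * (a * σ (pred q))
    σ-pred zero    = trans (ℤ.*-zeroˡ (σ 0)) (sym (ℤ.*-zeroˡ (a * σ 0)))
    σ-pred (suc q) = cong (+ suc q *_) (σ-suc q)

-- With q clique vertices left, ρA q and ρB q t are the values of R on stateA and stateB below, and σA q
-- and σB q t the sums over the closing paths that continue from a clique vertex.
module Recurrences (a : ℤ) (n : ℕ) where

  open import Data.Integer using (_+_; _*_; _-_; _^_)

  σB : ℕ → ℕ → ℤ
  σB q t = + suc t * a ^ q

  σA : ℕ → ℤ
  σA q = + suc n * a ^ suc q + a ^ q

  ρB : ℕ → ℕ → ℤ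
  ρB zero    t = + suc t
  ρB (suc q) t = a * ρB q t - σB q t

  ρA : ℕ → ℤ
  ρA zero    = a * + suc n - + n
  ρA (suc q) = a * ρA q - σA q

  σB-suc : ∀ q t → σB (suc q) t ≡ a * σB q t
  σB-suc q t = commute a (+ suc t) (a ^ q)
    where commute : ∀ a T P → T * (a * P) ≡ a * (T * P)
          commute = solve-∀

  σA-suc : ∀ q → σA (suc q) ≡ a * σA q
  σA-suc q = commute a (+ suc n) (a ^ q)
    where commute : ∀ a T P → T * (a * (a * P)) + a * P ≡ a * (T * (a * P) + P)
          commute = solve-∀

  σB-split : ∀ q t → ρB q t + + q * σB (pred q) t ≡ σB q t
  σB-split q t = trans (cong (_+_ (ρB q t)) (sym (ℤ.+-identityʳ _)))
    (σ-split a (λ q → ρB q t) (λ q → σB q t) (λ _ → + 0)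
             (λ _ → refl) (λ q → σB-suc q t) (λ _ → sym (ℤ.*-zeroʳ a)) base q)
    where base : ρB 0 t + + 0 ≡ σB 0 t
          base = trans (ℤ.+-identityʳ (+ suc t)) (sym (ℤ.*-identityʳ (+ suc t)))

  σA-split : ∀ q → ρA q + (+ q * σA (pred q) + σB q n) ≡ σA q
  σA-split = σ-split a ρA σA (λ q → σB q n) (λ _ → refl) σA-suc (λ q → σB-suc q n) (base a (+ n))
    where base : ∀ a N → a * (+ 1 + N) - N + (+ 1 + N) * + 1 ≡ (+ 1 + N) * (a * + 1) + + 1
          base = solve-∀

  plain-root : ∀ {ρ σ′ σ} → ρ + σ′ ≡ σ → (a - + 1) * ρ - σ′ ≡ a * ρ - σ
  plain-root {ρ} {σ′} refl = rearrange a ρ σ′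
    where rearrange : ∀ a ρ σ′ → (a - + 1) * ρ - σ′ ≡ a * ρ - (ρ + σ′)
          rearrange = solve-∀

  ρA-closed : ∀ q → ρA (suc q) ≡ (a * + suc n - + n) * (a - + suc q) * a ^ q - + suc q * a ^ q * + suc n
  ρA-closed zero    = base a (+ n)
    where base : ∀ a N → a * (a * (+ 1 + N) - N) - ((+ 1 + N) * (a * + 1) + + 1)
                       ≡ (a * (+ 1 + N) - N) * (a - + 1) * + 1 - + 1 * + 1 * (+ 1 + N)
          base = solve-∀
  ρA-closed (suc q) = trans (cong (λ r → a * r - σA (suc q)) (ρA-closed q)) (step a (+ n) (+ q) (a ^ q))
    where step : ∀ a N Q P → a * ((a * (+ 1 + N) - N) * (a - (+ 1 + Q)) * P - (+ 1 + Q) * P * (+ 1 + N))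
                               - ((+ 1 + N) * (a * (a * P)) + a * P)
                           ≡ (a * (+ 1 + N) - N) * (a - (+ 1 + (+ 1 + Q))) * (a * P) - (+ 1 + (+ 1 + Q)) * (a * P) * (+ 1 + N)
          step = solve-∀

clique : List ℕ → List LV
clique = map inj₁

path : ℕ → ℕ → List LV
path j t = map inj₂ (interval j t)

length-clique-++ : ∀ C L → length (clique C ++ L) ≡ length C ℕ.+ length L
length-clique-++ C L = trans (List.length-++ (clique C)) (cong (ℕ._+ length L) (List.length-map inj₁ C))

length-path : ∀ j t → length (path j t) ≡ t
length-path j zero    = refl
length-path j (suc t) = cong suc (length-path (suc j) t)

clique-fresh : ∀ {c C} → All (c ≢_) C → All (_≢ inj₁ c) (clique C)
clique-fresh c∉C = All.map⁺ (All.map (λ c≢d e → c≢d (sym (inj₁-injective e))) c∉C)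

path-≢-clique : ∀ i j t → All (_≢ inj₁ i) (path j t)
path-≢-clique i j t = All.map⁺ (All.universal (λ _ ()) (interval j t))

path-fresh : ∀ {l} j t → l < j → All (_≢ inj₂ l) (path j t)
path-fresh j t l<j = All.map⁺ (All.map (λ j≤l′ e → ℕ.<⇒≢ (ℕ.<-≤-trans l<j j≤l′) (sym (inj₂-injective e)))
                                       (interval-lower j t))

clique-adjacent : ∀ m {c i} → c ≢ i → lollipopAdj m (inj₁ c) (inj₁ i) ≡ true
clique-adjacent m {c} {i} c≢i = cong not (dec-false (c ℕ.≟ i) c≢i)

plain-path-nonadjacent : ∀ m {c} l → c ≢ m → lollipopAdj m (inj₁ c) (inj₂ l) ≡ false
plain-path-nonadjacent m {c} l c≢m = cong (_∧ (l ℕ.≡ᵇ 1)) (dec-false (c ℕ.≟ m) c≢m)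

plain-nonadjacent-path : ∀ m {c} j t → c ≢ m → All (λ v → lollipopAdj m (inj₁ c) v ≡ false) (path j t)
plain-nonadjacent-path m j t c≢m = All.map⁺ (All.universal (λ l → plain-path-nonadjacent m l c≢m) (interval j t))

apex-adjacent-y₁ : ∀ m → lollipopAdj m (inj₁ m) (inj₂ 1) ≡ true
apex-adjacent-y₁ m = cong (_∧ true) (dec-true (m ℕ.≟ m) refl)

apex-nonadjacent-path : ∀ m t → All (λ v → lollipopAdj m (inj₁ m) v ≡ false) (path 2 t)
apex-nonadjacent-path m t = All.map⁺ (All.map
  (λ 2≤l → cong₂ _∧_ (dec-true (m ℕ.≟ m) refl) (dec-false (_ ℕ.≟ 1) (ℕ.>⇒≢ 2≤l))) (interval-lower 2 t))

path-adjacent : ∀ m j → lollipopAdj m (inj₂ j) (inj₂ (suc j)) ≡ true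
path-adjacent m j = cong (_∨ (suc (suc j) ℕ.≡ᵇ j)) (dec-true (suc j ℕ.≟ suc j) refl)

path-nonadjacent : ∀ m j t → All (λ v → lollipopAdj m (inj₂ j) v ≡ false) (path (suc (suc j)) t)
path-nonadjacent m j t = All.map⁺ (All.map
  (λ j+2≤l → cong₂ _∨_ (dec-false (suc j ℕ.≟ _) (ℕ.<⇒≢ j+2≤l))
                       (dec-false (_ ℕ.≟ j) (ℕ.>⇒≢ (ℕ.<-trans (ℕ.n<1+n j) (ℕ.m<n⇒m<1+n j+2≤l)))))
  (interval-lower (suc (suc j)) t))

module LollipopExpansion (m n : ℕ) (w : LV → ℤ) (a : ℤ)
    (w-apex : w (inj₁ m) ≡ a) (w-path : ∀ l → w (inj₂ l) ≡ + 2) where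

  open import Data.Integer using (_+_; _*_; _-_)

  open Expansion _≟L_ (lollipopAdj m) w
  open Recurrences a n

  -- What is left of L_{m,n} after deleting a path from the clique: stateA still contains the apex x_m
  -- and the whole tail, stateB has lost x_m and keeps the tail segment y_j, ..., y_(j+t-1).
  stateA : List ℕ → List LV
  stateA C = clique C ++ inj₁ m ∷ path 1 n

  stateB : List ℕ → ℕ → ℕ → List LV
  stateB C j t = clique C ++ path j t

  Plain : List ℕ → Set
  Plain = All (λ c → c ≢ m × w (inj₁ c) ≡ a - + 1)

  clique-∖ : ∀ i C → clique C ∖ (inj₁ i ∷ []) ≡ clique (delete i C)
  clique-∖ i []      = refl
  clique-∖ i (c ∷ C) with c ℕ.≟ i
  ... | yes refl = trans (∖-self (inj₁ c) (clique C)) (trans (clique-∖ i C) (cong clique (sym (delete-self i C))))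
  ... | no c≢i   = trans (∖-keep (clique C) (c≢i ∘ inj₁-injective))
                         (trans (cong (inj₁ c ∷_) (clique-∖ i C)) (cong clique (sym (delete-keep C c≢i))))

  path-∖-clique : ∀ i j t → path j t ∖ (inj₁ i ∷ []) ≡ path j t
  path-∖-clique i j t = ∖-fresh (inj₁ i) (path j t) (path-≢-clique i j t)

  stateB-∖-clique : ∀ i C j t → stateB C j t ∖ (inj₁ i ∷ []) ≡ stateB (delete i C) j t
  stateB-∖-clique i C j t =
    trans (∖-++ (clique C) (path j t) (inj₁ i ∷ [])) (cong₂ _++_ (clique-∖ i C) (path-∖-clique i j t))

  stateA-∖-clique : ∀ {i} C → i ≢ m → stateA C ∖ (inj₁ i ∷ []) ≡ stateA (delete i C)
  stateA-∖-clique {i} C i≢m = trans (∖-++ (clique C) (inj₁ m ∷ path 1 n) (inj₁ i ∷ [])) (cong₂ _++_ (clique-∖ i C)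
    (trans (∖-keep (path 1 n) (λ e → i≢m (sym (inj₁-injective e)))) (cong (inj₁ m ∷_) (path-∖-clique i 1 n))))

  stateA-∖-apex : ∀ C → All (_≢ m) C → stateA C ∖ (inj₁ m ∷ []) ≡ stateB C 1 n
  stateA-∖-apex C m∉C = trans (∖-++ (clique C) (inj₁ m ∷ path 1 n) (inj₁ m ∷ [])) (cong₂ _++_
    (trans (clique-∖ m C) (cong clique (delete-fresh m∉C)))
    (trans (∖-self (inj₁ m) (path 1 n)) (path-∖-clique m 1 n)))

  stateB-fresh : ∀ {c C} j t → All (c ≢_) C → All (_≢ inj₁ c) (stateB C j t)
  stateB-fresh j t c∉C = All.++⁺ (clique-fresh c∉C) (path-≢-clique _ j t)

  stateA-fresh : ∀ {c C} → c ≢ m → All (c ≢_) C → All (_≢ inj₁ c) (stateA C)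
  stateA-fresh c≢m c∉C = All.++⁺ (clique-fresh c∉C) ((λ e → c≢m (sym (inj₁-injective e))) ∷ path-≢-clique _ 1 n)

  IsPath : LV → Set
  IsPath (inj₁ _) = ⊥
  IsPath (inj₂ _) = ⊤

  NotApex : LV → Set
  NotApex (inj₁ i) = i ≢ m
  NotApex (inj₂ _) = ⊤

  path-closed : ∀ {v u} → IsPath v → NotApex u → lollipopAdj m v u ≡ true → IsPath u
  path-closed {inj₂ l} {inj₁ i} _ i≢m v∼u = contradiction (trans (sym v∼u) (plain-path-nonadjacent m l i≢m)) (λ ())
  path-closed {inj₂ _} {inj₂ _} _ _ _ = _

  stateB-NotApex : ∀ {C} j t → Plain C → All NotApex (stateB C j t)
  stateB-NotApex j t plain = All.++⁺ (All.map⁺ (All.map proj₁ plain)) (All.map⁺ (All.universal _ (interval j t)))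

  record Evaluates (f : ℕ) : Set where
    field
      stateA-value : ∀ C → Plain C → Unique C → length C ℕ.+ suc n ≤ f → R[ f ] (stateA C) ≡ ρA (length C)
      stateB-value : ∀ C j t → Plain C → Unique C → length C ℕ.+ t ≤ f → R[ f ] (stateB C j t) ≡ ρB (length C) t

  Σ-clique : ∀ (g : LV → ℤ) c C → (∀ {i} → i ∈ C → g (inj₁ i) ≡ c) → Σ (map g (clique C)) ≡ + length C * c
  Σ-clique g c C g≡c = trans (cong Σ (sym (List.map-∘ C))) (Σ-map-const (g ∘ inj₁) c C (All.tabulate g≡c))

  module PlainRoot (c₀ : ℕ) (c₀≢m : c₀ ≢ m) (S : List LV) (f : ℕ) (ih : Evaluates f) where
    open PathSums (inj₁ c₀) S f public
    open Evaluates ih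

    Σ-path-vanishes : ∀ fe v rp av j t → All NotApex av → Σ (map (branchSum fe v rp av) (path j t)) ≡ + 0
    Σ-path-vanishes fe v rp av j t notApex = Σ-map-zero _ (path j t) (All.map⁺ (All.universal
      (λ _ → branchSum-vanishes path-nonadjacent-root path-closed fe rp av _ notApex) (interval j t)))
      where
      path-nonadjacent-root : ∀ {v} → IsPath v → lollipopAdj m (inj₁ c₀) v ≡ false
      path-nonadjacent-root {inj₁ _} ()
      path-nonadjacent-root {inj₂ l} _ = plain-path-nonadjacent m l c₀≢m

    extensionSum-B : ∀ fe c r rs C j t → (inj₁ c₀ ∷ S) ∖ (inj₁ c ∷ r ∷ rs) ≡ stateB C j t → c₀ ≢ c →
      Plain C → Unique (c ∷ C) → All (c₀ ≢_) C → length C < fe → length C ℕ.+ t ≤ f →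
      extensionSum fe (inj₁ c ∷ r ∷ rs) (stateB C j t) ≡ σB (length C) t
    Σ-branches-B : ∀ fe c rp C j t → (inj₁ c₀ ∷ S) ∖ (inj₁ c ∷ rp) ≡ stateB C j t →
      Plain C → Unique (c ∷ C) → All (c₀ ≢_) C → length C ≤ fe → length C ℕ.+ t ≤ f →
      Σ (map (branchSum fe (inj₁ c) rp (stateB C j t)) (stateB C j t)) ≡ + length C * σB (pred (length C)) t

    extensionSum-B (suc fe) c r rs C j t S∖P c₀≢c plain C!@(_ ∷ C!′) c₀∉C (s≤s C≤fe) bound = begin
      extensionSum (suc fe) (inj₁ c ∷ r ∷ rs) (stateB C j t)
        ≡⟨ extensionSum-suc fe (inj₁ c) (r ∷ rs) (stateB C j t) ⟩
      term (inj₁ c ∷ r ∷ rs) + Σ (map (branchSum fe (inj₁ c) (r ∷ rs) (stateB C j t)) (stateB C j t))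
        ≡⟨ cong₂ _+_ (trans (if-true (clique-adjacent m c₀≢c)) (trans (cong R[ f ]_ S∖P) (stateB-value C j t plain C!′ bound)))
                     (Σ-branches-B fe c (r ∷ rs) C j t S∖P plain C! c₀∉C C≤fe bound) ⟩
      ρB (length C) t + + length C * σB (pred (length C)) t
        ≡⟨ σB-split (length C) t ⟩
      σB (length C) t ∎
      where open ≡-Reasoning

    Σ-branches-B fe c rp C j t S∖P plain C!@(c∉C ∷ C!′) c₀∉C C≤fe bound = begin
      Σ (map br (clique C ++ path j t))
        ≡⟨ Σ-map-++ br (clique C) (path j t) ⟩
      Σ (map br (clique C)) + Σ (map br (path j t))
        ≡⟨ cong₂ _+_ (Σ-clique br _ C child) (Σ-path-vanishes fe (inj₁ c) rp (stateB C j t) j t (stateB-NotApex j t plain)) ⟩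
      + length C * σB (pred (length C)) t + + 0
        ≡⟨ ℤ.+-identityʳ _ ⟩
      + length C * σB (pred (length C)) t ∎
      where
      open ≡-Reasoning
      br = branchSum fe (inj₁ c) rp (stateB C j t)
      child : ∀ {i} → i ∈ C → br (inj₁ i) ≡ σB (pred (length C)) t
      child {i} i∈C = begin
        br (inj₁ i)
          ≡⟨ trans (if-true (clique-adjacent m (All.lookup c∉C i∈C))) (cong (extensionSum fe _) (stateB-∖-clique i C j t)) ⟩
        extensionSum fe (inj₁ i ∷ inj₁ c ∷ rp) (stateB (delete i C) j t)
          ≡⟨ extensionSum-B fe i (inj₁ c) rp (delete i C) j t
               (trans (∖-extend (inj₁ c₀ ∷ S) (inj₁ c ∷ rp) (inj₁ i) S∖P) (stateB-∖-clique i C j t)) (All.lookup c₀∉C i∈C)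
               (All-delete plain) (Unique-delete-∷ i C!′) (All-delete c₀∉C)
               (subst (_≤ fe) (sym (length-delete i∈C C!′)) C≤fe)
               (ℕ.≤-trans (ℕ.+-monoˡ-≤ t (length-delete-≤ i C)) bound) ⟩
        σB (length (delete i C)) t
          ≡⟨ cong (λ q → σB q t) (cong pred (length-delete i∈C C!′)) ⟩
        σB (pred (length C)) t ∎

    extensionSum-A : ∀ fe c r rs C → (inj₁ c₀ ∷ S) ∖ (inj₁ c ∷ r ∷ rs) ≡ stateA C → c₀ ≢ c → c ≢ m →
      Plain C → Unique (c ∷ C) → All (c₀ ≢_) C → suc (length C) < fe → length C ℕ.+ suc n ≤ f →
      extensionSum fe (inj₁ c ∷ r ∷ rs) (stateA C) ≡ σA (length C)
    Σ-branches-A : ∀ fe c rp C → (inj₁ c₀ ∷ S) ∖ (inj₁ c ∷ rp) ≡ stateA C → c ≢ m →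
      Plain C → Unique (c ∷ C) → All (c₀ ≢_) C → length C < fe → length C ℕ.+ suc n ≤ f →
      Σ (map (branchSum fe (inj₁ c) rp (stateA C)) (stateA C)) ≡ + length C * σA (pred (length C)) + σB (length C) n

    extensionSum-A (suc fe) c r rs C S∖P c₀≢c c≢m plain C!@(_ ∷ C!′) c₀∉C (s≤s C<fe) bound = begin
      extensionSum (suc fe) (inj₁ c ∷ r ∷ rs) (stateA C)
        ≡⟨ extensionSum-suc fe (inj₁ c) (r ∷ rs) (stateA C) ⟩
      term (inj₁ c ∷ r ∷ rs) + Σ (map (branchSum fe (inj₁ c) (r ∷ rs) (stateA C)) (stateA C))
        ≡⟨ cong₂ _+_ (trans (if-true (clique-adjacent m c₀≢c)) (trans (cong R[ f ]_ S∖P) (stateA-value C plain C!′ bound)))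
                     (Σ-branches-A fe c (r ∷ rs) C S∖P c≢m plain C! c₀∉C C<fe bound) ⟩
      ρA (length C) + (+ length C * σA (pred (length C)) + σB (length C) n)
        ≡⟨ σA-split (length C) ⟩
      σA (length C) ∎
      where open ≡-Reasoning

    Σ-branches-A fe c rp C S∖P c≢m plain C!@(c∉C ∷ C!′) c₀∉C C<fe bound = begin
      Σ (map br (clique C ++ inj₁ m ∷ path 1 n))
        ≡⟨ Σ-map-++ br (clique C) (inj₁ m ∷ path 1 n) ⟩
      Σ (map br (clique C)) + (br (inj₁ m) + Σ (map br (path 1 n)))
        ≡⟨ cong₂ _+_ (Σ-clique br _ C child)
                     (trans (cong₂ _+_ apex Σ-path) (ℤ.+-identityʳ _)) ⟩
      + length C * σA (pred (length C)) + σB (length C) n ∎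
      where
      open ≡-Reasoning
      br = branchSum fe (inj₁ c) rp (stateA C)
      Σ-path : Σ (map br (path 1 n)) ≡ + 0
      Σ-path = Σ-map-zero br (path 1 n) (All.map (branchSum-nonadjacent fe rp (stateA C)) (plain-nonadjacent-path m 1 n c≢m))
      m∉C : All (m ≢_) C
      m∉C = All.map (λ p → ≢-sym (proj₁ p)) plain
      apex : br (inj₁ m) ≡ σB (length C) n
      apex = begin
        br (inj₁ m)
          ≡⟨ trans (if-true (clique-adjacent m c≢m)) (cong (extensionSum fe _) (stateA-∖-apex C (All.map proj₁ plain))) ⟩
        extensionSum fe (inj₁ m ∷ inj₁ c ∷ rp) (stateB C 1 n)
          ≡⟨ extensionSum-B fe m (inj₁ c) rp C 1 n
               (trans (∖-extend (inj₁ c₀ ∷ S) (inj₁ c ∷ rp) (inj₁ m) S∖P) (stateA-∖-apex C (All.map proj₁ plain)))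
               c₀≢m plain (m∉C ∷ C!′) c₀∉C C<fe (ℕ.≤-trans (ℕ.+-monoʳ-≤ (length C) (ℕ.n≤1+n n)) bound) ⟩
        σB (length C) n ∎
      child : ∀ {i} → i ∈ C → br (inj₁ i) ≡ σA (pred (length C))
      child {i} i∈C = begin
        br (inj₁ i)
          ≡⟨ trans (if-true (clique-adjacent m (All.lookup c∉C i∈C))) (cong (extensionSum fe _) (stateA-∖-clique C i≢m)) ⟩
        extensionSum fe (inj₁ i ∷ inj₁ c ∷ rp) (stateA (delete i C))
          ≡⟨ extensionSum-A fe i (inj₁ c) rp (delete i C)
               (trans (∖-extend (inj₁ c₀ ∷ S) (inj₁ c ∷ rp) (inj₁ i) S∖P) (stateA-∖-clique C i≢m))
               (All.lookup c₀∉C i∈C) i≢m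
               (All-delete plain) (Unique-delete-∷ i C!′) (All-delete c₀∉C)
               (subst (_< fe) (sym (length-delete i∈C C!′)) C<fe)
               (ℕ.≤-trans (ℕ.+-monoˡ-≤ (suc n) (length-delete-≤ i C)) bound) ⟩
        σA (length (delete i C))
          ≡⟨ cong (σA ∘ pred) (length-delete i∈C C!′) ⟩
        σA (pred (length C)) ∎
        where
        i≢m : i ≢ m
        i≢m = proj₁ (All.lookup plain i∈C)

  module Steps (f : ℕ) (ih : Evaluates f) where
    open Evaluates ih

    stateB-step : ∀ c C j t → Plain (c ∷ C) → Unique (c ∷ C) → length (c ∷ C) ℕ.+ t ≤ suc f →
      R[ suc f ] (stateB (c ∷ C) j t) ≡ ρB (length (c ∷ C)) t
    stateB-step c C j t ((c≢m , w-c) ∷ plain) C!@(c∉C ∷ C!′) (s≤s bound) = begin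
      R[ suc f ] (inj₁ c ∷ S)
        ≡⟨ Rf-∷ f (inj₁ c) S c∉S ⟩
      w (inj₁ c) * R[ f ] S - Σ (map (branchSum (length S) (inj₁ c) [] S) S)
        ≡⟨ cong₂ (λ x y → x * R[ f ] S - y) w-c
             (Σ-branches-B (length S) c [] C j t (∖-head (inj₁ c) S c∉S) plain C! c∉C C≤S bound) ⟩
      (a - + 1) * R[ f ] S - + length C * σB (pred (length C)) t
        ≡⟨ cong (λ r → (a - + 1) * r - + length C * σB (pred (length C)) t) (stateB-value C j t plain C!′ bound) ⟩
      (a - + 1) * ρB (length C) t - + length C * σB (pred (length C)) t
        ≡⟨ plain-root (σB-split (length C) t) ⟩
      ρB (suc (length C)) t ∎
      where
      open ≡-Reasoning
      S = stateB C j t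
      open PlainRoot c c≢m S f ih
      c∉S = stateB-fresh j t c∉C
      C≤S : length C ≤ length S
      C≤S = subst (length C ≤_) (sym (length-clique-++ C (path j t))) (ℕ.m≤m+n (length C) _)

    stateA-step : ∀ c C → Plain (c ∷ C) → Unique (c ∷ C) → length (c ∷ C) ℕ.+ suc n ≤ suc f →
      R[ suc f ] (stateA (c ∷ C)) ≡ ρA (length (c ∷ C))
    stateA-step c C ((c≢m , w-c) ∷ plain) C!@(c∉C ∷ C!′) (s≤s bound) = begin
      R[ suc f ] (inj₁ c ∷ S)
        ≡⟨ Rf-∷ f (inj₁ c) S c∉S ⟩
      w (inj₁ c) * R[ f ] S - Σ (map (branchSum (length S) (inj₁ c) [] S) S)
        ≡⟨ cong₂ (λ x y → x * R[ f ] S - y) w-c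
             (Σ-branches-A (length S) c [] C (∖-head (inj₁ c) S c∉S) c≢m plain C! c∉C C<S bound) ⟩
      (a - + 1) * R[ f ] S - (+ length C * σA (pred (length C)) + σB (length C) n)
        ≡⟨ cong (λ r → (a - + 1) * r - (+ length C * σA (pred (length C)) + σB (length C) n)) (stateA-value C plain C!′ bound) ⟩
      (a - + 1) * ρA (length C) - (+ length C * σA (pred (length C)) + σB (length C) n)
        ≡⟨ plain-root (σA-split (length C)) ⟩
      ρA (suc (length C)) ∎
      where
      open ≡-Reasoning
      S = stateA C
      open PlainRoot c c≢m S f ih
      c∉S = stateA-fresh c≢m c∉C
      C<S : length C < length S
      C<S = subst (length C <_) (sym (length-clique-++ C (inj₁ m ∷ path 1 n))) (ℕ.m<m+n (length C) (s≤s z≤n))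

    R-empty : R[ f ] [] ≡ + 1
    R-empty = stateB-value [] 0 0 [] [] z≤n

    apex-step : ∀ t → t ≤ f → R[ suc f ] (inj₁ m ∷ path 1 t) ≡ a * + suc t - + t
    apex-step zero    _ = trans (Rf-∷ f (inj₁ m) [] []) (cong₂ (λ x r → x * r - + 0) w-apex R-empty)
    apex-step (suc t) t<f = begin
      R[ suc f ] (inj₁ m ∷ inj₂ 1 ∷ path 2 t)
        ≡⟨ Rf-pendant f (inj₁ m) (inj₂ 1) (path 2 t) (apex-adjacent-y₁ m) (apex-nonadjacent-path m t)
             (path-≢-clique m 1 (suc t)) (path-fresh 2 t (s≤s (s≤s z≤n))) ⟩
      w (inj₁ m) * R[ f ] (path 1 (suc t)) - R[ f ] (path 2 t)
        ≡⟨ cong₂ _-_ (cong₂ _*_ w-apex (stateB-value [] 1 (suc t) [] [] t<f))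
                     (stateB-value [] 2 t [] [] (ℕ.≤-trans (ℕ.n≤1+n t) t<f)) ⟩
      a * + suc (suc t) - + suc t ∎
      where open ≡-Reasoning

    path-step : ∀ j t → suc t ≤ suc f → R[ suc f ] (path j (suc t)) ≡ + suc (suc t)
    path-step j zero    _ = trans (Rf-∷ f (inj₂ j) [] []) (cong₂ (λ x r → x * r - + 0) (w-path j) R-empty)
    path-step j (suc t) (s≤s t<f) = begin
      R[ suc f ] (inj₂ j ∷ inj₂ (suc j) ∷ path (suc (suc j)) t)
        ≡⟨ Rf-pendant f (inj₂ j) (inj₂ (suc j)) (path (suc (suc j)) t) (path-adjacent m j) (path-nonadjacent m j t)
             (path-fresh (suc j) (suc t) (ℕ.n<1+n j)) (path-fresh (suc (suc j)) t (ℕ.n<1+n (suc j))) ⟩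
      w (inj₂ j) * R[ f ] (path (suc j) (suc t)) - R[ f ] (path (suc (suc j)) t)
        ≡⟨ cong₂ _-_ (cong₂ _*_ (w-path j) (stateB-value [] (suc j) (suc t) [] [] t<f))
                     (stateB-value [] (suc (suc j)) t [] [] (ℕ.≤-trans (ℕ.n≤1+n t) t<f)) ⟩
      + 2 * + suc (suc t) - + suc t
        ≡⟨ path-recurrence (+ suc t) ⟩
      + suc (suc (suc t)) ∎
      where
      open ≡-Reasoning
      path-recurrence : ∀ T → + 2 * (+ 1 + T) - T ≡ + 1 + (+ 1 + T)
      path-recurrence = solve-∀

  evaluates : ∀ f → Evaluates f
  evaluates zero = record { stateA-value = λ { [] _ _ () ; (_ ∷ _) _ _ () } ; stateB-value = stateB-value }
    where
    stateB-value : ∀ C j t → Plain C → Unique C → length C ℕ.+ t ≤ 0 → R[ 0 ] (stateB C j t) ≡ ρB (length C) t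
    stateB-value [] j zero _ _ _ = refl
  evaluates (suc f) = record { stateA-value = stateA-value ; stateB-value = stateB-value }
    where
    open Steps f (evaluates f)
    stateA-value : ∀ C → Plain C → Unique C → length C ℕ.+ suc n ≤ suc f → R[ suc f ] (stateA C) ≡ ρA (length C)
    stateA-value []      _     _  (s≤s n≤f) = apex-step n n≤f
    stateA-value (c ∷ C) plain C! bound     = stateA-step c C plain C! bound
    stateB-value : ∀ C j t → Plain C → Unique C → length C ℕ.+ t ≤ suc f → R[ suc f ] (stateB C j t) ≡ ρB (length C) t
    stateB-value []      j zero    _     _  _     = refl
    stateB-value []      j (suc t) _     _  bound = path-step j t bound
    stateB-value (c ∷ C) j t       plain C! bound = stateB-step c C j t plain C! bound

  R-stateA : ∀ C → Plain C → Unique C → R _≟L_ (lollipopAdj m) w (stateA C) ≡ ρA (length C)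
  R-stateA C plain C! = Evaluates.stateA-value (evaluates _) C plain C!
    (ℕ.≤-reflexive (sym (trans (length-clique-++ C _) (cong (λ l → length C ℕ.+ suc l) (length-path 1 n)))))

applyUpTo-interval : ∀ f s t → (∀ i → f i ≡ s ℕ.+ i) → applyUpTo f t ≡ interval s t
applyUpTo-interval f s zero    f≗s+ = refl
applyUpTo-interval f s (suc t) f≗s+ = cong₂ _∷_ (trans (f≗s+ 0) (ℕ.+-identityʳ s))
  (applyUpTo-interval (λ i → f (suc i)) (suc s) t (λ i → trans (f≗s+ (suc i)) (ℕ.+-suc s i)))

range1-interval : ∀ n → range1 n ≡ interval 1 n
range1-interval n = trans (List.map-applyUpTo id suc n) (applyUpTo-interval suc 1 n (λ _ → refl))

Unique-range1 : ∀ m → Unique (range1 m)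
Unique-range1 m = Unique.map⁺ ℕ.suc-injective (Unique.upTo⁺ m)

length-range1 : ∀ m → length (range1 m) ≡ m
length-range1 m = trans (List.length-map suc (upTo m)) (List.length-upTo m)

range1-∷ʳ : ∀ m → range1 (suc m) ≡ range1 m ++ suc m ∷ []
range1-∷ʳ m = trans (cong (map suc) (sym (List.upTo-∷ʳ m))) (List.map-++ suc (upTo m) (m ∷ []))

module LollipopDegrees (m′ n : ℕ) where

  m : ℕ
  m = suc m′

  open Degree _≟L_ (lollipopAdj m)

  deg : List LV → ℕ → ℕ
  deg L i = degree _≟L_ (lollipopAdj m) L (inj₁ i)

  deg-clique : ∀ i C → deg (clique C) i ≡ length (delete i C)
  deg-clique i []      = refl
  deg-clique i (c ∷ C) with c ℕ.≟ i
  ... | yes refl = trans (degree-∷-nonadjacent (inj₁ c) (inj₁ c) (clique C) (cong not (dec-true (c ℕ.≟ c) refl)))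
                         (trans (deg-clique c C) (cong length (sym (delete-self c C))))
  ... | no c≢i   = trans (degree-∷-adjacent (inj₁ i) (inj₁ c) (clique C) (clique-adjacent m (λ e → c≢i (sym e))))
                         (trans (cong suc (deg-clique i C)) (cong length (sym (delete-keep C c≢i))))

  deg-lollipop : ∀ i → suc i ℕ.≤ m → deg (lollipopVerts m n) (suc i) ≡ m′ ℕ.+ deg (path 1 n) (suc i)
  deg-lollipop i i<m = begin
    deg (clique (range1 m) ++ map inj₂ (range1 n)) (suc i)
      ≡⟨ degree-++ (clique (range1 m)) (map inj₂ (range1 n)) (inj₁ (suc i)) ⟩
    deg (clique (range1 m)) (suc i) ℕ.+ deg (map inj₂ (range1 n)) (suc i)
      ≡⟨ cong₂ ℕ._+_ (trans (deg-clique (suc i) (range1 m)) (ℕ.suc-injective (trans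
                        (length-delete (∈-map⁺ suc (∈-upTo⁺ i<m)) (Unique-range1 m)) (length-range1 m))))
                     (cong (λ L → deg (map inj₂ L) (suc i)) (range1-interval n)) ⟩
    m′ ℕ.+ deg (path 1 n) (suc i) ∎
    where open ≡-Reasoning

  deg-path-plain : ∀ {i} j t → i ≢ m → deg (path j t) i ≡ 0
  deg-path-plain {i} j t i≢m = degree-nonadjacent (inj₁ i) (path j t) (plain-nonadjacent-path m j t i≢m)

  deg-path-apex : ∀ n′ → deg (path 1 (suc n′)) m ≡ 1
  deg-path-apex n′ = trans (degree-∷-adjacent (inj₁ m) (inj₂ 1) (path 2 n′) (apex-adjacent-y₁ m))
    (cong suc (degree-nonadjacent (inj₁ m) (path 2 n′) (apex-nonadjacent-path m n′)))

lollipopVerts-split : ∀ m′ n → lollipopVerts (suc m′) n ≡ clique (range1 m′) ++ inj₁ (suc m′) ∷ path 1 n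
lollipopVerts-split m′ n = begin
  clique (range1 (suc m′)) ++ map inj₂ (range1 n)
    ≡⟨ cong₂ (λ C L → clique C ++ map inj₂ L) (range1-∷ʳ m′) (range1-interval n) ⟩
  clique (range1 m′ ++ suc m′ ∷ []) ++ path 1 n
    ≡⟨ cong (_++ path 1 n) (List.map-++ inj₁ (range1 m′) (suc m′ ∷ [])) ⟩
  (clique (range1 m′) ++ inj₁ (suc m′) ∷ []) ++ path 1 n
    ≡⟨ List.++-assoc (clique (range1 m′)) (inj₁ (suc m′) ∷ []) (path 1 n) ⟩
  clique (range1 m′) ++ inj₁ (suc m′) ∷ path 1 n ∎
  where open ≡-Reasoning

module LollipopWeights (m′ n′ k : ℕ) where

  m n : ℕ
  m = suc m′
  n = suc n′

  a : ℤ
  a = + (m ℕ.+ k)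

  open LollipopDegrees m′ n using (deg-lollipop; deg-path-plain; deg-path-apex)

  Dk-apex : Dk m n k (inj₁ m) ≡ a
  Dk-apex = cong (λ d → + (d ℕ.+ k))
    (trans (deg-lollipop m′ ℕ.≤-refl) (trans (cong (m′ ℕ.+_) (deg-path-apex n′)) (ℕ.+-comm m′ 1)))

  open LollipopExpansion m n (Dk m n k) a Dk-apex (λ _ → refl)

  Plain-range1 : Plain (range1 m′)
  Plain-range1 = All.map⁺ (All.applyUpTo⁺₁ id m′ λ {i} i<m′ →
    let i+1≢m = λ e → ℕ.<-irrefl (ℕ.suc-injective e) i<m′ in
    i+1≢m , cong (λ d → + (d ℕ.+ k))
              (trans (deg-lollipop i (ℕ.m≤n⇒m≤1+n i<m′))
                     (trans (cong (m′ ℕ.+_) (deg-path-plain 1 n i+1≢m)) (ℕ.+-identityʳ m′))))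

  R-lollipop : RG (Lollipop m n) (Dk m n k) ≡ Recurrences.ρA a n m′
  R-lollipop = trans (cong (R _≟L_ (lollipopAdj m) (Dk m n k)) (lollipopVerts-split m′ n))
    (trans (R-stateA (range1 m′) Plain-range1 (Unique-range1 m′)) (cong (Recurrences.ρA a n) (length-range1 m′)))

toℚᵘ-ℤ→ℚ : ∀ z → ℚ.toℚᵘ (ℤ→ℚ z) ℚᵘ.≃ mkℚᵘ z 0
toℚᵘ-ℤ→ℚ z = ℚ.toℚᵘ-fromℚᵘ (mkℚᵘ z 0)

ℤ→ℚ-+ : ∀ x y → ℤ→ℚ (x ℤ.+ y) ≡ ℤ→ℚ x +ℚ ℤ→ℚ y
ℤ→ℚ-+ x y = ℚ.toℚᵘ-injective (ℚᵘ.≃-trans (toℚᵘ-ℤ→ℚ (x ℤ.+ y)) (ℚᵘ.≃-trans (*≡* (denominators x y))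
  (ℚᵘ.≃-sym (ℚᵘ.≃-trans (ℚ.toℚᵘ-homo-+ (ℤ→ℚ x) (ℤ→ℚ y)) (ℚᵘ.+-cong (toℚᵘ-ℤ→ℚ x) (toℚᵘ-ℤ→ℚ y))))))
  where denominators : ∀ x y → (x ℤ.+ y) ℤ.* + 1 ≡ (x ℤ.* + 1 ℤ.+ y ℤ.* + 1) ℤ.* + 1
        denominators = solve-∀

ℤ→ℚ-* : ∀ x y → ℤ→ℚ (x ℤ.* y) ≡ ℤ→ℚ x *ℚ ℤ→ℚ y
ℤ→ℚ-* x y = ℚ.toℚᵘ-injective (ℚᵘ.≃-trans (toℚᵘ-ℤ→ℚ (x ℤ.* y)) (ℚᵘ.≃-trans (*≡* refl)
  (ℚᵘ.≃-sym (ℚᵘ.≃-trans (ℚ.toℚᵘ-homo-* (ℤ→ℚ x) (ℤ→ℚ y)) (ℚᵘ.*-cong (toℚᵘ-ℤ→ℚ x) (toℚᵘ-ℤ→ℚ y))))))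

ℤ→ℚ-neg : ∀ x → ℤ→ℚ (ℤ.- x) ≡ -ℚ ℤ→ℚ x
ℤ→ℚ-neg x = ℚ.toℚᵘ-injective (ℚᵘ.≃-trans (toℚᵘ-ℤ→ℚ (ℤ.- x))
  (ℚᵘ.≃-sym (ℚᵘ.≃-trans (ℚ.toℚᵘ-homo‿- (ℤ→ℚ x)) (ℚᵘ.-‿cong (toℚᵘ-ℤ→ℚ x)))))

ℤ→ℚ-- : ∀ x y → ℤ→ℚ (x ℤ.- y) ≡ ℤ→ℚ x -ℚ ℤ→ℚ y
ℤ→ℚ-- x y = trans (ℤ→ℚ-+ x (ℤ.- y)) (cong (ℤ→ℚ x +ℚ_) (ℤ→ℚ-neg y))

ℤ→ℚ-^ : ∀ x q → ℤ→ℚ (x ℤ.^ q) ≡ ℤ→ℚ x ^ℕ q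
ℤ→ℚ-^ x zero    = refl
ℤ→ℚ-^ x (suc q) = trans (ℤ→ℚ-* x (x ℤ.^ q)) (cong (ℤ→ℚ x *ℚ_) (ℤ→ℚ-^ x q))

^ℤ-inverse : ∀ p → p ≢ 0ℚ → p *ℚ (p ^ℤ -[1+ 0 ]) ≡ 1ℚ
^ℤ-inverse p p≢0 with p ℚ.≟ 0ℚ
... | yes p≡0 = ⊥-elim (p≢0 p≡0)
... | no p≢0′ = trans (cong (p *ℚ_) (ℚ.*-identityʳ (1/_ p {{ℚ.≢-nonZero p≢0′}})))
                      (ℚ.*-inverseʳ p {{ℚ.≢-nonZero p≢0′}})

ℕ→ℚ-suc≢0 : ∀ k → ℕ→ℚ (suc k) ≢ 0ℚ
ℕ→ℚ-suc≢0 k e with ℚᵘ.≃-trans (ℚᵘ.≃-sym (toℚᵘ-ℤ→ℚ (+ suc k))) (ℚᵘ.≃-reflexive (cong ℚ.toℚᵘ e))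
... | *≡* ()

ℤ→ℚ-shape : ∀ X T N K M q →
  ℤ→ℚ ((X ℤ.* T ℤ.- N) ℤ.* K ℤ.* X ℤ.^ q ℤ.- M ℤ.* X ℤ.^ q ℤ.* T)
    ≡ ((ℤ→ℚ X *ℚ ℤ→ℚ T -ℚ ℤ→ℚ N) *ℚ ℤ→ℚ K *ℚ ℤ→ℚ X ^ℕ q) -ℚ (ℤ→ℚ M *ℚ ℤ→ℚ X ^ℕ q *ℚ ℤ→ℚ T)
ℤ→ℚ-shape X T N K M q = begin
  ℤ→ℚ (L ℤ.* P ℤ.- M ℤ.* P ℤ.* T)
    ≡⟨ ℤ→ℚ-- (L ℤ.* P) (M ℤ.* P ℤ.* T) ⟩
  ℤ→ℚ (L ℤ.* P) -ℚ ℤ→ℚ (M ℤ.* P ℤ.* T)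
    ≡⟨ cong₂ _-ℚ_ (trans (ℤ→ℚ-* L P) (cong₂ _*ℚ_ L-hom P-hom))
                  (trans (ℤ→ℚ-* (M ℤ.* P) T) (cong (_*ℚ ℤ→ℚ T) (trans (ℤ→ℚ-* M P) (cong (ℤ→ℚ M *ℚ_) P-hom)))) ⟩
  ((ℤ→ℚ X *ℚ ℤ→ℚ T -ℚ ℤ→ℚ N) *ℚ ℤ→ℚ K *ℚ ℤ→ℚ X ^ℕ q) -ℚ (ℤ→ℚ M *ℚ ℤ→ℚ X ^ℕ q *ℚ ℤ→ℚ T) ∎
  where
  open ≡-Reasoning
  L = (X ℤ.* T ℤ.- N) ℤ.* K
  P = X ℤ.^ q
  P-hom : ℤ→ℚ P ≡ ℤ→ℚ X ^ℕ q
  P-hom = ℤ→ℚ-^ X q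
  L-hom : ℤ→ℚ L ≡ (ℤ→ℚ X *ℚ ℤ→ℚ T -ℚ ℤ→ℚ N) *ℚ ℤ→ℚ K
  L-hom = trans (ℤ→ℚ-* (X ℤ.* T ℤ.- N) K)
                (cong (_*ℚ ℤ→ℚ K) (trans (ℤ→ℚ-- (X ℤ.* T) N) (cong (_-ℚ ℤ→ℚ N) (ℤ→ℚ-* X T))))

open import Data.Nat using (_+_; _∸_)
open import Data.Integer using () renaming (_-_ to _-ℤ_)

closed-form : ∀ m′ n′ k → let m = suc m′; n = suc n′ in
  ℤ→ℚ (Recurrences.ρA (+ (m + k)) n m′)
    ≡ ((ℕ→ℚ (m + k) *ℚ ℕ→ℚ (n + 1) -ℚ ℕ→ℚ n) *ℚ ℕ→ℚ (k + 1) *ℚ (ℕ→ℚ (m + k) ^ℤ (+ m -ℤ + 2)))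
      -ℚ (ℕ→ℚ (m ∸ 1) *ℚ (ℕ→ℚ (m + k) ^ℤ (+ m -ℤ + 2)) *ℚ ℕ→ℚ (n + 1))
closed-form (suc q) n′ k =
  trans (cong ℤ→ℚ (trans (ρA-closed q) (regroup (+ q) (+ k) (+ n) (a ℤ.^ q))))
        (ℤ→ℚ-shape a (+ (n + 1)) (+ n) (+ (k + 1)) (+ suc q) q)
  where
  n = suc n′
  a = + (suc (suc q) + k)
  open Recurrences a n
  regroup : ∀ Q K N P → let a = + 1 ℤ.+ (+ 1 ℤ.+ Q) ℤ.+ K in
    (a ℤ.* (+ 1 ℤ.+ N) -ℤ N) ℤ.* (a -ℤ (+ 1 ℤ.+ Q)) ℤ.* P -ℤ (+ 1 ℤ.+ Q) ℤ.* P ℤ.* (+ 1 ℤ.+ N)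
      ≡ (a ℤ.* (N ℤ.+ + 1) -ℤ N) ℤ.* (K ℤ.+ + 1) ℤ.* P -ℤ (+ 1 ℤ.+ Q) ℤ.* P ℤ.* (N ℤ.+ + 1)
  regroup = solve-∀
-- For m = 1 the factor (m + k)^(m - 2) is the inverse of k + 1.
closed-form zero n′ k = begin
  ℤ→ℚ (a ℤ.* + suc n -ℤ + n)
    ≡⟨ cong (λ T → ℤ→ℚ (a ℤ.* + T -ℤ + n)) (ℕ.+-comm 1 n) ⟩
  ℤ→ℚ (a ℤ.* + (n + 1) -ℤ + n)
    ≡⟨ trans (ℤ→ℚ-- (a ℤ.* + (n + 1)) (+ n)) (cong (_-ℚ ℕ→ℚ n) (ℤ→ℚ-* a (+ (n + 1)))) ⟩
  X
    ≡⟨ sym (ℚ.+-identityʳ X) ⟩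
  X +ℚ 0ℚ
    ≡⟨ cong₂ _-ℚ_ (sym X*K*P≡X)
                  (sym (trans (cong (_*ℚ ℕ→ℚ (n + 1)) (ℚ.*-zeroˡ P)) (ℚ.*-zeroˡ (ℕ→ℚ (n + 1))))) ⟩
  X *ℚ ℕ→ℚ (k + 1) *ℚ P -ℚ 0ℚ *ℚ P *ℚ ℕ→ℚ (n + 1) ∎
  where
  open ≡-Reasoning
  n = suc n′
  a = + suc k
  X = ℤ→ℚ a *ℚ ℕ→ℚ (n + 1) -ℚ ℕ→ℚ n
  P = ℤ→ℚ a ^ℤ -[1+ 0 ]
  X*K*P≡X : X *ℚ ℕ→ℚ (k + 1) *ℚ P ≡ X
  X*K*P≡X = begin
    X *ℚ ℕ→ℚ (k + 1) *ℚ P ≡⟨ ℚ.*-assoc X (ℕ→ℚ (k + 1)) P ⟩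
    X *ℚ (ℕ→ℚ (k + 1) *ℚ P) ≡⟨ cong (λ K → X *ℚ (ℕ→ℚ K *ℚ P)) (ℕ.+-comm k 1) ⟩
    X *ℚ (ℤ→ℚ a *ℚ P) ≡⟨ cong (X *ℚ_) (^ℤ-inverse (ℤ→ℚ a) (ℕ→ℚ-suc≢0 k)) ⟩
    X *ℚ 1ℚ ≡⟨ ℚ.*-identityʳ X ⟩
    X ∎

lemma4p2 : (m n k : ℕ) → 1 ≤ m → 1 ≤ n →
    ℤ→ℚ (RG (Lollipop m n) (Dk m n k))
    ≡ ((ℕ→ℚ (m + k) *ℚ ℕ→ℚ (n + 1) -ℚ ℕ→ℚ n) *ℚ ℕ→ℚ (k + 1) *ℚ (ℕ→ℚ (m + k) ^ℤ (+ m -ℤ + 2)))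
    -ℚ (ℕ→ℚ (m ∸ 1) *ℚ (ℕ→ℚ (m + k) ^ℤ (+ m -ℤ + 2)) *ℚ ℕ→ℚ (n + 1))
lemma4p2 (suc m′) (suc n′) k _ _ = trans (cong ℤ→ℚ (LollipopWeights.R-lollipop m′ n′ k)) (closed-form m′ n′ k)
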